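{- Let $m,n\ge 2$ be integers. For \textsc{Closed Geodetic Game} on the complete bipartite graph $K_{m,n}$: if $m$ and $n$ have the same parity then $\mathcal{G}(K_{m,n})=0$; otherwise $\mathcal{G}(K_{m,n})=2$.
   Context: For vertices $x,y$, $\mathcal{I}(x,y)$ is the set of vertices on some shortest $x$–$y$ path ($\mathcal{I}(x,x)=\{x\}$); for a vertex set $S$, the geodetic closure is $(S)=\bigcup_{x,y\in S}\mathcal{I}(x,y)$. \textsc{Closed Geodetic Game} on a graph: starting from $S=\emptyset$, two players alternately add to $S$ a vertex not in the current closure $(S)$; when $(S)$ is the whole vertex set there is no legal move and the game ends; the player making the last move wins. The options of a position are the positions reachable by one legal move; the Sprague–Grundy value is $\mathcal{G}(P)=\operatorname{mex}\{\mathcal{G}(P'):P'\text{ an option of }P\}$, where $\operatorname{mex}(X)$ is the least nonnegative integer not in $X$. $\mathcal{G}(H)$ for a graph $H$ denotes the value of the initial position (nothing selected). -}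

module Defs where

open import Level using (0ℓ)
open import Data.Nat using (ℕ; zero; suc; _<_)
open import Data.Fin using (Fin; zero; suc; fromℕ; inject₁)
open import Data.Sum using (_⊎_; inj₁; inj₂)
open import Data.Product using (Σ; ∃; _×_; _,_)
open import Data.Unit using (⊤)
open import Data.Empty using (⊥)
open import Data.List using (List; []; _∷_)
open import Data.List.Membership.Propositional using (_∈_)
open import Relation.Nullary using (¬_)
open import Relation.Binary.PropositionalEquality using (_≡_; _≢_)

record Graph : Set₁ where
  field
    Vertex : Set
    Adj    : Vertex → Vertex → Set

open Graph public

record Walk (G : Graph) (x y : Vertex G) (k : ℕ) : Set where
  field
    pt    : Fin (suc k) → Vertex G
    start : pt zero ≡ x
    end   : pt (fromℕ k) ≡ y
    adj   : (i : Fin k) → Adj G (pt (inject₁ i)) (pt (suc i))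

open Walk public

record ShortestPath (G : Graph) (x y : Vertex G) : Set where
  field
    len      : ℕ
    walk     : Walk G x y len
    minimal  : (j : ℕ) → j < len → ¬ Walk G x y j

open ShortestPath public

-- I(x,y): z lies on some shortest x–y path.  (I(x,x) = {x}: the only
-- shortest x–x path is the trivial one of length 0.)
Interval : (G : Graph) → Vertex G → Vertex G → Vertex G → Set
Interval G x y z = Σ (ShortestPath G x y) λ P → ∃ λ (i : Fin (suc (len P))) → pt (walk P) i ≡ z

InClosure : (G : Graph) → List (Vertex G) → Vertex G → Set
InClosure G S z = ∃ λ x → ∃ λ y → x ∈ S × y ∈ S × Interval G x y z

-- Sprague–Grundy value of a position S (the set of selected vertices) of
-- Closed Geodetic Game, as an inductive relation  HasGrundy G S g  meaning
-- 𝒢(S) = g.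
-- Being inductive, the relation only holds at well-founded positions and
-- assigns at most one value to each position.
data HasGrundy (G : Graph) (S : List (Vertex G)) (g : ℕ) : Set where
  mex : ((v : Vertex G) → ¬ InClosure G S v →
           Σ ℕ λ h → HasGrundy G (v ∷ S) h × h ≢ g)
      → ((h : ℕ) → h < g →
           Σ (Vertex G) λ v → ¬ InClosure G S v × HasGrundy G (v ∷ S) h)
      → HasGrundy G S g

K : ℕ → ℕ → Graph
Vertex (K m n) = Fin m ⊎ Fin n
Adj (K m n) (inj₁ _) (inj₁ _) = ⊥
Adj (K m n) (inj₁ _) (inj₂ _) = ⊤
Adj (K m n) (inj₂ _) (inj₁ _) = ⊤
Adj (K m n) (inj₂ _) (inj₂ _) = ⊥

{-# OPTIONS --safe #-}

-- In K m n the geodetic closure of S is S itself, plus the whole right part as soon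
-- as S contains two left vertices, and symmetrically.  So once two vertices of one
-- part are chosen the remaining moves are exactly the unchosen vertices of that part,
-- and such a position is worth the parity of their number; in particular the first
-- position with two left vertices is worth m mod 2.  Working back through the few
-- positions with at most one vertex in each part, using K m n ≅ K n m, gives the value
-- mex {mex {p, mex {p, q}}, mex {q, mex {q, p}}} with p = m mod 2 and q = n mod 2.

module Submission where

open import Defs
open import Data.Nat using (ℕ; zero; suc; _≤_; _<_; _%_; _∸_; z≤n; s≤s)
open import Data.Nat.Properties using (<-cmp; suc-injective)
open import Data.Nat.DivMod using (m%n<n)
open import Data.Fin using (Fin; zero; suc; punchIn; fromℕ<) renaming (_≟_ to _≟ᶠ_)
open import Data.Fin.Properties using (punchInᵢ≢i)
open import Data.Fin.Subset using (Subset; inside; outside; ⊥; ⁅_⁆; _∪_; ∁; ∣_∣; Nonempty)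
  renaming (_∈_ to _∈ₛ_; _∉_ to _∉ₛ_)
open import Data.Fin.Subset.Properties
  using (∉⊥; x∈⁅x⁆; x∈⁅y⁆⇒x≡y; x∈p∪q⁺; x∈p∪q⁻; ∪-identityˡ; ∪-identityʳ; x∈∁p⇒x∉p; x∉∁p⇒x∈p;
         ∣∁p∣≡n∸∣p∣; ∣⊥∣≡0)
open import Data.List using (List; []; _∷_; map)
open import Data.Vec.Base using (_∷_; here; there)
open import Data.List.Properties using (map-∘; map-cong; map-id)
open import Data.List.Membership.Propositional using (_∈_)
open import Data.List.Membership.Propositional.Properties using (∈-map⁺; ∈-map⁻)
open import Data.List.Relation.Unary.Any using (here; there)
open import Data.Product using (Σ; _×_; _,_)
open import Data.Sum using (_⊎_; inj₁; inj₂; swap; [_,_]′)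
open import Data.Sum.Properties using (inj₁-injective; inj₂-injective; swap-involutive; swap-↔)
open import Data.Empty using (⊥-elim)
open import Function using (_∘_; _↔_; Inverse)
open import Function.Bundles using (_⇔_; mk⇔)
open import Function.Properties.Inverse using (↔-sym)
open import Relation.Binary using (tri<; tri≈; tri>)
open import Relation.Binary.PropositionalEquality
  using (module ≡-Reasoning; _≡_; _≢_; refl; sym; trans; cong; subst; subst₂)
open import Relation.Nullary using (¬_; yes; no)

private
  variable
    G H : Graph
    g h k : ℕ

-- Grundy values

HasGrundy-functional : ∀ {S} → HasGrundy G S g → HasGrundy G S h → g ≡ h
HasGrundy-functional {g = g} {h = h} (mex avoid₁ attain₁) (mex avoid₂ attain₂) with <-cmp g h
... | tri≈ _ g≡h _ = g≡h
... | tri< g<h _ _ =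
  let (v , v-legal , v-value) = attain₂ g g<h
      (h′ , v-value′ , h′≢g)   = avoid₁ v v-legal
  in ⊥-elim (h′≢g (HasGrundy-functional v-value′ v-value))
... | tri> _ _ h<g =
  let (v , v-legal , v-value) = attain₁ h h<g
      (h′ , v-value′ , h′≢h)   = avoid₂ v v-legal
  in ⊥-elim (h′≢h (HasGrundy-functional v-value′ v-value))

mex₂ : ℕ → ℕ → ℕ
mex₂ (suc _) (suc _) = 0
mex₂ 0       1       = 2
mex₂ 1       0       = 2
mex₂ _       _       = 1

mex₂-≢ˡ : ∀ a b → mex₂ a b ≢ a
mex₂-≢ˡ 0             0             ()
mex₂-≢ˡ 0             1             ()
mex₂-≢ˡ 0             (suc (suc _)) ()
mex₂-≢ˡ 1             0             ()
mex₂-≢ˡ (suc (suc _)) 0             ()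
mex₂-≢ˡ (suc _)       (suc _)       ()

mex₂-≢ʳ : ∀ a b → mex₂ a b ≢ b
mex₂-≢ʳ 0             0             ()
mex₂-≢ʳ 0             1             ()
mex₂-≢ʳ 0             (suc (suc _)) ()
mex₂-≢ʳ 1             0             ()
mex₂-≢ʳ (suc (suc _)) 0             ()
mex₂-≢ʳ (suc _)       (suc _)       ()

mex₂-minimal : ∀ a b → h < mex₂ a b → h ≡ a ⊎ h ≡ b
mex₂-minimal {0}           0             _             _ = inj₁ refl
mex₂-minimal {0}           (suc _)       0             _ = inj₂ refl
mex₂-minimal {1}           0             1             _ = inj₂ refl
mex₂-minimal {1}           1             0             _ = inj₁ refl
mex₂-minimal {suc _}       0             0             (s≤s ())
mex₂-minimal {suc _}       0             (suc (suc _)) (s≤s ())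
mex₂-minimal {suc _}       (suc (suc _)) 0             (s≤s ())
mex₂-minimal {suc (suc _)} 0             1             (s≤s (s≤s ()))
mex₂-minimal {suc (suc _)} 1             0             (s≤s (s≤s ()))
mex₂-minimal {_}           (suc _)       (suc _)       ()

HasGrundy-mex₂ : ∀ {S} a b →
  ((v : Vertex G) → ¬ InClosure G S v → HasGrundy G (v ∷ S) a ⊎ HasGrundy G (v ∷ S) b) →
  Σ (Vertex G) (λ v → ¬ InClosure G S v × HasGrundy G (v ∷ S) a) →
  Σ (Vertex G) (λ v → ¬ InClosure G S v × HasGrundy G (v ∷ S) b) →
  HasGrundy G S (mex₂ a b)
HasGrundy-mex₂ {G = G} {S = S} a b option-values option-a option-b = mex avoid attain
  where
  avoid : (v : Vertex G) → ¬ InClosure G S v → Σ ℕ λ h → HasGrundy G (v ∷ S) h × h ≢ mex₂ a b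
  avoid v v-legal with option-values v v-legal
  ... | inj₁ v-value = a , v-value , mex₂-≢ˡ a b ∘ sym
  ... | inj₂ v-value = b , v-value , mex₂-≢ʳ a b ∘ sym
  attain : (h : ℕ) → h < mex₂ a b → Σ (Vertex G) λ v → ¬ InClosure G S v × HasGrundy G (v ∷ S) h
  attain h h<mex with mex₂-minimal a b h<mex
  ... | inj₁ refl = option-a
  ... | inj₂ refl = option-b

HasGrundy-terminal : ∀ {S} → ((v : Vertex G) → InClosure G S v) → HasGrundy G S 0
HasGrundy-terminal closed = mex (λ v v-legal → ⊥-elim (v-legal (closed v))) (λ _ ())

mex₂-parity : ∀ k → mex₂ (k % 2) (k % 2) ≡ suc k % 2
mex₂-parity 0             = refl
mex₂-parity 1             = refl
mex₂-parity (suc (suc k)) = mex₂-parity k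

-- Invariance under graph isomorphism

Walk-map : ∀ {x y} (f : Vertex G → Vertex H) → (∀ {u v} → Adj G u v → Adj H (f u) (f v)) →
           Walk G x y k → Walk H (f x) (f y) k
Walk-map f f-adj w = record
  { pt    = f ∘ pt w
  ; start = cong f (start w)
  ; end   = cong f (end w)
  ; adj   = f-adj ∘ adj w
  }

record _≅_ (G H : Graph) : Set where
  field
    vertices : Vertex G ↔ Vertex H
  open Inverse vertices public using (to; from; strictlyInverseˡ; strictlyInverseʳ)
  field
    to-adj   : ∀ {u v} → Adj G u v → Adj H (to u) (to v)
    from-adj : ∀ {u v} → Adj H u v → Adj G (from u) (from v)

≅-sym : G ≅ H → H ≅ G
≅-sym G≅H = record { vertices = ↔-sym vertices ; to-adj = from-adj ; from-adj = to-adj }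
  where open _≅_ G≅H

module _ (G≅H : G ≅ H) where
  open _≅_ G≅H

  ShortestPath-≅ : ∀ {x y} → ShortestPath G x y → ShortestPath H (to x) (to y)
  ShortestPath-≅ {x} {y} P = record
    { len     = len P
    ; walk    = Walk-map to to-adj (walk P)
    ; minimal = λ j j<len w → minimal P j j<len
        (subst₂ (λ u v → Walk G u v j) (strictlyInverseʳ x) (strictlyInverseʳ y) (Walk-map from from-adj w))
    }

  InClosure-≅ : ∀ {S z} → InClosure G S z → InClosure H (map to S) (to z)
  InClosure-≅ (x , y , x∈S , y∈S , P , i , pᵢ≡z) =
    to x , to y , ∈-map⁺ to x∈S , ∈-map⁺ to y∈S , ShortestPath-≅ P , i , cong to pᵢ≡z

HasGrundy-≅ : ∀ {S} (G≅H : G ≅ H) → HasGrundy G S g → HasGrundy H (map (_≅_.to G≅H) S) g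
HasGrundy-≅ {G = G} {H = H} {g = g} {S = S} G≅H (mex avoid attain) = mex avoid′ attain′
  where
  open _≅_ G≅H
  reflect : ∀ {z} → InClosure H (map to S) (to z) → InClosure G S z
  reflect {z} c = subst₂ (InClosure G) from∘to-map (strictlyInverseʳ z) (InClosure-≅ (≅-sym G≅H) c)
    where
    from∘to-map : map from (map to S) ≡ S
    from∘to-map = trans (sym (map-∘ S)) (trans (map-cong strictlyInverseʳ S) (map-id S))
  avoid′ : (w : Vertex H) → ¬ InClosure H (map to S) w →
           Σ ℕ λ h → HasGrundy H (w ∷ map to S) h × h ≢ g
  avoid′ w w-legal =
    let (h , v-value , h≢g) =
          avoid (from w) (w-legal ∘ subst (InClosure H _) (strictlyInverseˡ w) ∘ InClosure-≅ G≅H)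
    in h , subst (λ u → HasGrundy H (u ∷ map to S) h) (strictlyInverseˡ w) (HasGrundy-≅ G≅H v-value) , h≢g
  attain′ : (h : ℕ) → h < g → Σ (Vertex H) λ w → ¬ InClosure H (map to S) w × HasGrundy H (w ∷ map to S) h
  attain′ h h<g =
    let (v , v-legal , v-value) = attain h h<g
    in to v , v-legal ∘ reflect , HasGrundy-≅ G≅H v-value

-- Shortest paths of length at most two

module _ {G : Graph} where

  walk₀ : (x : Vertex G) → Walk G x x 0
  walk₀ x = record { pt = λ _ → x ; start = refl ; end = refl ; adj = λ () }

  walk₁ : ∀ {x y} → Adj G x y → Walk G x y 1
  walk₁ {x} {y} x~y = record { pt = p ; start = refl ; end = refl ; adj = λ { zero → x~y } }
    where
    p : Fin 2 → Vertex G
    p zero    = x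
    p (suc _) = y

  walk₂ : ∀ {x c y} → Adj G x c → Adj G c y → Walk G x y 2
  walk₂ {x} {c} {y} x~c c~y =
    record { pt = p ; start = refl ; end = refl ; adj = λ { zero → x~c ; (suc zero) → c~y } }
    where
    p : Fin 3 → Vertex G
    p zero          = x
    p (suc zero)    = c
    p (suc (suc _)) = y

  Walk0⇒≡ : ∀ {x y} → Walk G x y 0 → x ≡ y
  Walk0⇒≡ w = trans (sym (start w)) (end w)

  Walk1⇒Adj : ∀ {x y} → Walk G x y 1 → Adj G x y
  Walk1⇒Adj w = subst₂ (Adj G) (start w) (end w) (adj w zero)

  first-step : ∀ {x y L} (w : Walk G x y (suc L)) → Adj G x (pt w (suc zero))
  first-step w = subst (λ u → Adj G u _) (start w) (adj w zero)

  ∈⇒InClosure : ∀ {S z} → z ∈ S → InClosure G S z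
  ∈⇒InClosure {z = z} z∈S =
    z , z , z∈S , z∈S , record { len = 0 ; walk = walk₀ z ; minimal = λ _ () } , zero , refl

  ¬InClosure[] : ∀ {z} → ¬ InClosure G [] z
  ¬InClosure[] (_ , _ , () , _)

  Interval-common-neighbour : ∀ {x c y} → x ≢ y → ¬ Adj G x y → Adj G x c → Adj G c y → Interval G x y c
  Interval-common-neighbour {x} {c} {y} x≢y x≁y x~c c~y =
    record { len = 2 ; walk = walk₂ x~c c~y ; minimal = shorter } , suc zero , refl
    where
    shorter : (j : ℕ) → j < 2 → ¬ Walk G x y j
    shorter 0 _ w = x≢y (Walk0⇒≡ w)
    shorter 1 _ w = x≁y (Walk1⇒Adj w)
    shorter (suc (suc _)) (s≤s (s≤s ()))

  Interval-self : ∀ {x z} → Interval G x x z → z ≡ x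
  Interval-self (record { len = zero ; walk = w } , zero , e) = trans (sym e) (start w)
  Interval-self {x} (record { len = suc _ ; minimal = shortest } , _) =
    ⊥-elim (shortest 0 (s≤s z≤n) (walk₀ x))

  Interval-adjacent : ∀ {x y z} → x ≢ y → Adj G x y → Interval G x y z → z ≡ x ⊎ z ≡ y
  Interval-adjacent x≢y _ (record { len = zero ; walk = w } , _) = ⊥-elim (x≢y (Walk0⇒≡ w))
  Interval-adjacent _ _ (record { len = 1 ; walk = w } , zero , e)     = inj₁ (trans (sym e) (start w))
  Interval-adjacent _ _ (record { len = 1 ; walk = w } , suc zero , e) = inj₂ (trans (sym e) (end w))
  Interval-adjacent _ x~y (record { len = suc (suc _) ; minimal = shortest } , _) =
    ⊥-elim (shortest 1 (s≤s (s≤s z≤n)) (walk₁ x~y))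

  Interval-distance-two : ∀ {x y z} → x ≢ y → ¬ Adj G x y → (∀ {c} → Adj G x c → Adj G c y) →
                          Interval G x y z → z ≡ x ⊎ z ≡ y ⊎ Adj G x z
  Interval-distance-two x≢y _ _ (record { len = zero ; walk = w } , _) = ⊥-elim (x≢y (Walk0⇒≡ w))
  Interval-distance-two _ x≁y _ (record { len = 1 ; walk = w } , _) = ⊥-elim (x≁y (Walk1⇒Adj w))
  Interval-distance-two _ _ _ (record { len = 2 ; walk = w } , zero , e) = inj₁ (trans (sym e) (start w))
  Interval-distance-two _ _ _ (record { len = 2 ; walk = w } , suc zero , e) =
    inj₂ (inj₂ (subst (Adj G _) e (first-step w)))
  Interval-distance-two _ _ _ (record { len = 2 ; walk = w } , suc (suc zero) , e) =
    inj₂ (inj₁ (trans (sym e) (end w)))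
  Interval-distance-two _ _ onward (record { len = suc (suc (suc _)) ; walk = w ; minimal = shortest } , _) =
    ⊥-elim (shortest 2 (s≤s (s≤s (s≤s z≤n))) (walk₂ (first-step w) (onward (first-step w))))

-- Subsets of Fin n

x∉p⇒∣∁p∣≡1+∣∁[⁅x⁆∪p]∣ : ∀ {n} {x : Fin n} {p} → x ∉ₛ p → ∣ ∁ p ∣ ≡ suc ∣ ∁ (⁅ x ⁆ ∪ p) ∣
x∉p⇒∣∁p∣≡1+∣∁[⁅x⁆∪p]∣ {x = zero}  {p = outside ∷ p} _   = cong (suc ∘ ∣_∣ ∘ ∁) (sym (∪-identityˡ p))
x∉p⇒∣∁p∣≡1+∣∁[⁅x⁆∪p]∣ {x = zero}  {p = inside ∷ p}  x∉p = ⊥-elim (x∉p here)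
x∉p⇒∣∁p∣≡1+∣∁[⁅x⁆∪p]∣ {x = suc x} {p = outside ∷ p} x∉p = cong suc (x∉p⇒∣∁p∣≡1+∣∁[⁅x⁆∪p]∣ (x∉p ∘ there))
x∉p⇒∣∁p∣≡1+∣∁[⁅x⁆∪p]∣ {x = suc x} {p = inside ∷ p}  x∉p = x∉p⇒∣∁p∣≡1+∣∁[⁅x⁆∪p]∣ (x∉p ∘ there)

∣p∣≡0⇒x∉p : ∀ {n} {x : Fin n} {p} → ∣ p ∣ ≡ 0 → x ∉ₛ p
∣p∣≡0⇒x∉p {p = outside ∷ p} ∣p∣≡0 (there x∈p) = ∣p∣≡0⇒x∉p ∣p∣≡0 x∈p
∣p∣≡0⇒x∉p {p = inside ∷ p}  ()

∣p∣≡1+k⇒Nonempty : ∀ {n} {p : Subset n} {k} → ∣ p ∣ ≡ suc k → Nonempty p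
∣p∣≡1+k⇒Nonempty {p = inside ∷ p}  _ = zero , here
∣p∣≡1+k⇒Nonempty {p = outside ∷ p} ∣p∣≡1+k with ∣p∣≡1+k⇒Nonempty ∣p∣≡1+k
... | x , x∈p = suc x , there x∈p

Pair : ∀ {n} → Subset n → Set
Pair p = Σ _ λ x → Σ _ λ y → x ≢ y × x ∈ₛ p × y ∈ₛ p

Pair-∪ : ∀ {n} {p : Subset n} q → Pair p → Pair (q ∪ p)
Pair-∪ _ (x , y , x≢y , x∈p , y∈p) = x , y , x≢y , x∈p∪q⁺ (inj₂ x∈p) , x∈p∪q⁺ (inj₂ y∈p)

x∈⁅y⁆∪⊥⇒x≡y : ∀ {n} {x y : Fin n} → x ∈ₛ ⁅ y ⁆ ∪ ⊥ → x ≡ y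
x∈⁅y⁆∪⊥⇒x≡y {y = y} x∈ = x∈⁅y⁆⇒x≡y y (subst (_ ∈ₛ_) (∪-identityʳ ⁅ y ⁆) x∈)

¬Pair[⁅x⁆∪⊥] : ∀ {n} {x : Fin n} → ¬ Pair (⁅ x ⁆ ∪ ⊥)
¬Pair[⁅x⁆∪⊥] (_ , _ , y≢z , y∈ , z∈) = y≢z (trans (x∈⁅y⁆∪⊥⇒x≡y y∈) (sym (x∈⁅y⁆∪⊥⇒x≡y z∈)))

¬Pair⊥ : ∀ {n} → ¬ Pair (⊥ {n})
¬Pair⊥ (_ , _ , _ , y∈⊥ , _) = ∉⊥ y∈⊥

-- The geodetic closure in K m n

module _ {m n : ℕ} where

  selected₁ : List (Fin m ⊎ Fin n) → Subset m
  selected₁ []           = ⊥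
  selected₁ (inj₁ a ∷ S) = ⁅ a ⁆ ∪ selected₁ S
  selected₁ (inj₂ _ ∷ S) = selected₁ S

  ∈-selected₁⁺ : ∀ {a S} → inj₁ a ∈ S → a ∈ₛ selected₁ S
  ∈-selected₁⁺ {S = inj₁ a ∷ _} (here refl) = x∈p∪q⁺ (inj₁ (x∈⁅x⁆ a))
  ∈-selected₁⁺ {S = inj₁ _ ∷ _} (there a∈S) = x∈p∪q⁺ (inj₂ (∈-selected₁⁺ a∈S))
  ∈-selected₁⁺ {S = inj₂ _ ∷ _} (there a∈S) = ∈-selected₁⁺ a∈S

  ∈-selected₁⁻ : ∀ {a S} → a ∈ₛ selected₁ S → inj₁ a ∈ S
  ∈-selected₁⁻ {S = []}         a∈ = ⊥-elim (∉⊥ a∈)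
  ∈-selected₁⁻ {S = inj₁ b ∷ S} a∈ with x∈p∪q⁻ ⁅ b ⁆ (selected₁ S) a∈
  ... | inj₁ a∈⁅b⁆ = here (cong inj₁ (x∈⁅y⁆⇒x≡y b a∈⁅b⁆))
  ... | inj₂ a∈S   = there (∈-selected₁⁻ a∈S)
  ∈-selected₁⁻ {S = inj₂ _ ∷ S} a∈ = there (∈-selected₁⁻ a∈)

selected₂ : ∀ {m n} → List (Fin m ⊎ Fin n) → Subset n
selected₂ S = selected₁ (map swap S)

module _ {m n : ℕ} where

  ∈-selected₂⁺ : ∀ {b} {S : List (Fin m ⊎ Fin n)} → inj₂ b ∈ S → b ∈ₛ selected₂ S
  ∈-selected₂⁺ b∈S = ∈-selected₁⁺ (∈-map⁺ swap b∈S)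

  ∈-selected₂⁻ : ∀ {b} {S : List (Fin m ⊎ Fin n)} → b ∈ₛ selected₂ S → inj₂ b ∈ S
  ∈-selected₂⁻ {S = S} b∈ with ∈-map⁻ swap (∈-selected₁⁻ b∈)
  ... | v , v∈S , inj₁b≡swap-v =
    subst (_∈ S) (trans (sym (swap-involutive v)) (cong swap (sym inj₁b≡swap-v))) v∈S

  InClosureK : List (Fin m ⊎ Fin n) → Fin m ⊎ Fin n → Set
  InClosureK S (inj₁ a) = a ∈ₛ selected₁ S ⊎ Pair (selected₂ S)
  InClosureK S (inj₂ b) = b ∈ₛ selected₂ S ⊎ Pair (selected₁ S)

  InClosure-K⁺ : ∀ {S z} → InClosureK S z → InClosure (K m n) S z
  InClosure-K⁺ {z = inj₁ a} (inj₁ a∈) = ∈⇒InClosure (∈-selected₁⁻ a∈)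
  InClosure-K⁺ {z = inj₂ b} (inj₁ b∈) = ∈⇒InClosure (∈-selected₂⁻ b∈)
  InClosure-K⁺ {z = inj₁ a} (inj₂ (b , b′ , b≢b′ , b∈ , b′∈)) =
    inj₂ b , inj₂ b′ , ∈-selected₂⁻ b∈ , ∈-selected₂⁻ b′∈ ,
    Interval-common-neighbour (b≢b′ ∘ inj₂-injective) (λ ()) _ _
  InClosure-K⁺ {z = inj₂ b} (inj₂ (a , a′ , a≢a′ , a∈ , a′∈)) =
    inj₁ a , inj₁ a′ , ∈-selected₁⁻ a∈ , ∈-selected₁⁻ a′∈ ,
    Interval-common-neighbour (a≢a′ ∘ inj₁-injective) (λ ()) _ _

  InClosure-K⁻ : ∀ {S z} → InClosure (K m n) S z → InClosureK S z
  InClosure-K⁻ {S} {z} (x , y , x∈S , y∈S , I) = from-interval x y x∈S y∈S I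
    where
    member : ∀ {v} → v ∈ S → InClosureK S v
    member {inj₁ _} v∈S = inj₁ (∈-selected₁⁺ v∈S)
    member {inj₂ _} v∈S = inj₁ (∈-selected₂⁺ v∈S)
    endpoint : ∀ {x y} → x ∈ S → y ∈ S → z ≡ x ⊎ z ≡ y → InClosureK S z
    endpoint x∈S _   (inj₁ refl) = member x∈S
    endpoint _   y∈S (inj₂ refl) = member y∈S
    across₁ : ∀ {a} w → Pair (selected₁ S) → Adj (K m n) (inj₁ a) w → InClosureK S w
    across₁ (inj₂ _) pair _ = inj₂ pair
    across₂ : ∀ {b} w → Pair (selected₂ S) → Adj (K m n) (inj₂ b) w → InClosureK S w
    across₂ (inj₁ _) pair _ = inj₂ pair
    from-interval : ∀ x y → x ∈ S → y ∈ S → Interval (K m n) x y z → InClosureK S z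
    from-interval (inj₁ _) (inj₂ _) x∈S y∈S I = endpoint x∈S y∈S (Interval-adjacent (λ ()) _ I)
    from-interval (inj₂ _) (inj₁ _) x∈S y∈S I = endpoint x∈S y∈S (Interval-adjacent (λ ()) _ I)
    from-interval (inj₁ a) (inj₁ a′) x∈S y∈S I with a ≟ᶠ a′
    ... | yes refl = endpoint x∈S y∈S (inj₁ (Interval-self I))
    ... | no a≢a′
      with Interval-distance-two (a≢a′ ∘ inj₁-injective) (λ ()) (λ { {inj₂ _} _ → _ ; {inj₁ _} () }) I
    ...   | inj₁ z≡x        = endpoint x∈S y∈S (inj₁ z≡x)
    ...   | inj₂ (inj₁ z≡y) = endpoint x∈S y∈S (inj₂ z≡y)
    ...   | inj₂ (inj₂ x~z) = across₁ z (a , a′ , a≢a′ , ∈-selected₁⁺ x∈S , ∈-selected₁⁺ y∈S) x~z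
    from-interval (inj₂ b) (inj₂ b′) x∈S y∈S I with b ≟ᶠ b′
    ... | yes refl = endpoint x∈S y∈S (inj₁ (Interval-self I))
    ... | no b≢b′
      with Interval-distance-two (b≢b′ ∘ inj₂-injective) (λ ()) (λ { {inj₁ _} _ → _ ; {inj₂ _} () }) I
    ...   | inj₁ z≡x        = endpoint x∈S y∈S (inj₁ z≡x)
    ...   | inj₂ (inj₁ z≡y) = endpoint x∈S y∈S (inj₂ z≡y)
    ...   | inj₂ (inj₂ x~z) = across₂ z (b , b′ , b≢b′ , ∈-selected₂⁺ x∈S , ∈-selected₂⁺ y∈S) x~z

K-swap-adj : ∀ {m n} u v → Adj (K m n) u v → Adj (K n m) (swap u) (swap v)
K-swap-adj (inj₁ _) (inj₂ _) _ = _
K-swap-adj (inj₂ _) (inj₁ _) _ = _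

K-swap : ∀ {m n} → K m n ≅ K n m
K-swap = record
  { vertices = swap-↔
  ; to-adj   = λ {u} {v} → K-swap-adj u v
  ; from-adj = λ {u} {v} → K-swap-adj u v
  }

-- Positions of the game on K m n

module _ {m n : ℕ} where

  HasGrundy-countdown : ∀ k (S : List (Fin m ⊎ Fin n)) → Pair (selected₁ S) → ¬ Pair (selected₂ S) →
                        ∣ ∁ (selected₁ S) ∣ ≡ k → HasGrundy (K m n) S (k % 2)
  HasGrundy-countdown zero S pair₁ _ ∣∁p∣≡0 = HasGrundy-terminal closed
    where
    closed : ∀ v → InClosure (K m n) S v
    closed (inj₁ a) = InClosure-K⁺ (inj₁ (x∉∁p⇒x∈p (∣p∣≡0⇒x∉p ∣∁p∣≡0)))
    closed (inj₂ b) = InClosure-K⁺ (inj₂ pair₁)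
  HasGrundy-countdown (suc k) S pair₁ ¬pair₂ ∣∁p∣≡1+k =
    subst (HasGrundy (K m n) S) (mex₂-parity k)
      (HasGrundy-mex₂ (k % 2) (k % 2) (λ v legal → inj₁ (options v legal)) some-option some-option)
    where
    select : ∀ a → a ∉ₛ selected₁ S → HasGrundy (K m n) (inj₁ a ∷ S) (k % 2)
    select a a∉ = HasGrundy-countdown k (inj₁ a ∷ S) (Pair-∪ ⁅ a ⁆ pair₁) ¬pair₂
      (suc-injective (trans (sym (x∉p⇒∣∁p∣≡1+∣∁[⁅x⁆∪p]∣ a∉)) ∣∁p∣≡1+k))
    options : ∀ v → ¬ InClosure (K m n) S v → HasGrundy (K m n) (v ∷ S) (k % 2)
    options (inj₁ a) legal = select a (legal ∘ InClosure-K⁺ ∘ inj₁)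
    options (inj₂ _) legal = ⊥-elim (legal (InClosure-K⁺ (inj₂ pair₁)))
    some-option : Σ _ λ v → ¬ InClosure (K m n) S v × HasGrundy (K m n) (v ∷ S) (k % 2)
    some-option =
      let (a , a∈∁p) = ∣p∣≡1+k⇒Nonempty ∣∁p∣≡1+k
          a∉p        = x∈∁p⇒x∉p a∈∁p
      in inj₁ a , [ a∉p , ¬pair₂ ]′ ∘ InClosure-K⁻ , select a a∉p

  HasGrundy-leftPair : ∀ {x x′ : Fin m} {T : List (Fin m ⊎ Fin n)} → x′ ≢ x → selected₁ T ≡ ⁅ x ⁆ ∪ ⊥ →
                       ¬ Pair (selected₂ T) → HasGrundy (K m n) (inj₁ x′ ∷ T) (m % 2)
  HasGrundy-leftPair {x} {x′} {T} x′≢x T≡x ¬pair₂ =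
    subst (λ k → HasGrundy (K m n) (inj₁ x′ ∷ T) (k % 2)) (sym count)
      (HasGrundy-countdown _ (inj₁ x′ ∷ T) pair₁ ¬pair₂ refl)
    where
    open ≡-Reasoning
    x′∉T : x′ ∉ₛ selected₁ T
    x′∉T = x′≢x ∘ x∈⁅y⁆∪⊥⇒x≡y ∘ subst (x′ ∈ₛ_) T≡x
    pair₁ : Pair (⁅ x′ ⁆ ∪ selected₁ T)
    pair₁ = x′ , x , x′≢x , x∈p∪q⁺ (inj₁ (x∈⁅x⁆ x′)) ,
            x∈p∪q⁺ (inj₂ (subst (x ∈ₛ_) (sym T≡x) (x∈p∪q⁺ (inj₁ (x∈⁅x⁆ x)))))
    count : m ≡ suc (suc ∣ ∁ (⁅ x′ ⁆ ∪ selected₁ T) ∣)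
    count = begin
      m                                      ≡⟨ cong (m ∸_) (∣⊥∣≡0 m) ⟨
      m ∸ ∣ ⊥ {m} ∣                           ≡⟨ ∣∁p∣≡n∸∣p∣ (⊥ {m}) ⟨
      ∣ ∁ (⊥ {m}) ∣                           ≡⟨ x∉p⇒∣∁p∣≡1+∣∁[⁅x⁆∪p]∣ {x = x} ∉⊥ ⟩
      suc ∣ ∁ (⁅ x ⁆ ∪ ⊥) ∣                    ≡⟨ cong (suc ∘ ∣_∣ ∘ ∁) T≡x ⟨
      suc ∣ ∁ (selected₁ T) ∣                 ≡⟨ cong suc (x∉p⇒∣∁p∣≡1+∣∁[⁅x⁆∪p]∣ x′∉T) ⟩
      suc (suc ∣ ∁ (⁅ x′ ⁆ ∪ selected₁ T) ∣)   ∎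

another : ∀ {n} → 2 ≤ n → (x : Fin n) → Σ (Fin n) (_≢ x)
another (s≤s (s≤s _)) x = punchIn x zero , punchInᵢ≢i x zero

HasGrundy-edge : ∀ {m n} → 2 ≤ m → 2 ≤ n → (x : Fin m) (y : Fin n) →
                 HasGrundy (K m n) (inj₂ y ∷ inj₁ x ∷ []) (mex₂ (m % 2) (n % 2))
HasGrundy-edge {m} {n} 2≤m 2≤n x y = HasGrundy-mex₂ (m % 2) (n % 2) options left-option right-option
  where
  S = inj₂ y ∷ inj₁ x ∷ []
  options : ∀ v → ¬ InClosure (K m n) S v →
            HasGrundy (K m n) (v ∷ S) (m % 2) ⊎ HasGrundy (K m n) (v ∷ S) (n % 2)
  options (inj₁ x′) legal =
    inj₁ (HasGrundy-leftPair (λ { refl → legal (∈⇒InClosure (there (here refl))) }) refl ¬Pair[⁅x⁆∪⊥])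
  -- A right move is the mirror image, under K-swap, of a left move in K n m:
  -- map swap turns inj₁ y′ ∷ inj₁ y ∷ inj₂ x ∷ [] into y′ ∷ S.
  options (inj₂ y′) legal =
    inj₂ (HasGrundy-≅ K-swap (HasGrundy-leftPair (λ { refl → legal (∈⇒InClosure (here refl)) }) refl ¬Pair[⁅x⁆∪⊥]))
  left-option : Σ _ λ v → ¬ InClosure (K m n) S v × HasGrundy (K m n) (v ∷ S) (m % 2)
  left-option =
    let (x′ , x′≢x) = another 2≤m x
    in inj₁ x′ , [ x′≢x ∘ x∈⁅y⁆∪⊥⇒x≡y , ¬Pair[⁅x⁆∪⊥] ]′ ∘ InClosure-K⁻ , HasGrundy-leftPair x′≢x refl ¬Pair[⁅x⁆∪⊥]
  right-option : Σ _ λ v → ¬ InClosure (K m n) S v × HasGrundy (K m n) (v ∷ S) (n % 2)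
  right-option =
    let (y′ , y′≢y) = another 2≤n y
    in inj₂ y′ , [ y′≢y ∘ x∈⁅y⁆∪⊥⇒x≡y , ¬Pair[⁅x⁆∪⊥] ]′ ∘ InClosure-K⁻ ,
       HasGrundy-≅ K-swap (HasGrundy-leftPair y′≢y refl ¬Pair[⁅x⁆∪⊥])

vertexValue : ℕ → ℕ → ℕ
vertexValue p q = mex₂ p (mex₂ p q)

rootValue : ℕ → ℕ → ℕ
rootValue p q = mex₂ (vertexValue p q) (vertexValue q p)

HasGrundy-leftVertex : ∀ {m n} → 2 ≤ m → 2 ≤ n → (x : Fin m) →
                       HasGrundy (K m n) (inj₁ x ∷ []) (vertexValue (m % 2) (n % 2))
HasGrundy-leftVertex {m} {n} 2≤m 2≤n x =
  HasGrundy-mex₂ (m % 2) (mex₂ (m % 2) (n % 2)) options left-option right-option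
  where
  S = inj₁ x ∷ []
  options : ∀ v → ¬ InClosure (K m n) S v →
            HasGrundy (K m n) (v ∷ S) (m % 2) ⊎ HasGrundy (K m n) (v ∷ S) (mex₂ (m % 2) (n % 2))
  options (inj₁ x′) legal = inj₁ (HasGrundy-leftPair (λ { refl → legal (∈⇒InClosure (here refl)) }) refl ¬Pair⊥)
  options (inj₂ y)  _     = inj₂ (HasGrundy-edge 2≤m 2≤n x y)
  left-option : Σ _ λ v → ¬ InClosure (K m n) S v × HasGrundy (K m n) (v ∷ S) (m % 2)
  left-option =
    let (x′ , x′≢x) = another 2≤m x
    in inj₁ x′ , [ x′≢x ∘ x∈⁅y⁆∪⊥⇒x≡y , ¬Pair⊥ ]′ ∘ InClosure-K⁻ , HasGrundy-leftPair x′≢x refl ¬Pair⊥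
  right-option : Σ _ λ v → ¬ InClosure (K m n) S v × HasGrundy (K m n) (v ∷ S) (mex₂ (m % 2) (n % 2))
  right-option = inj₂ y , [ ∉⊥ , ¬Pair[⁅x⁆∪⊥] ]′ ∘ InClosure-K⁻ , HasGrundy-edge 2≤m 2≤n x y
    where
    y : Fin n
    y = fromℕ< 2≤n

HasGrundy-K : ∀ {m n} → 2 ≤ m → 2 ≤ n → HasGrundy (K m n) [] (rootValue (m % 2) (n % 2))
HasGrundy-K {m} {n} 2≤m 2≤n = HasGrundy-mex₂ _ _ options
  (inj₁ (fromℕ< 2≤m) , ¬InClosure[] , HasGrundy-leftVertex 2≤m 2≤n (fromℕ< 2≤m))
  (inj₂ (fromℕ< 2≤n) , ¬InClosure[] , HasGrundy-≅ K-swap (HasGrundy-leftVertex 2≤n 2≤m (fromℕ< 2≤n)))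
  where
  options : ∀ v → ¬ InClosure (K m n) [] v →
            HasGrundy (K m n) (v ∷ []) (vertexValue (m % 2) (n % 2)) ⊎
            HasGrundy (K m n) (v ∷ []) (vertexValue (n % 2) (m % 2))
  options (inj₁ x) _ = inj₁ (HasGrundy-leftVertex 2≤m 2≤n x)
  options (inj₂ y) _ = inj₂ (HasGrundy-≅ K-swap (HasGrundy-leftVertex 2≤n 2≤m y))

rootValue-same : ∀ {p q} → p < 2 → q < 2 → p ≡ q → rootValue p q ≡ 0
rootValue-same {0}           _              _ refl = refl
rootValue-same {1}           _              _ refl = refl
rootValue-same {suc (suc _)} (s≤s (s≤s ())) _ _

rootValue-different : ∀ {p q} → p < 2 → q < 2 → p ≢ q → rootValue p q ≡ 2
rootValue-different {0}           {0}           _ _ p≢q = ⊥-elim (p≢q refl)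
rootValue-different {0}           {1}           _ _ _   = refl
rootValue-different {1}           {0}           _ _ _   = refl
rootValue-different {1}           {1}           _ _ p≢q = ⊥-elim (p≢q refl)
rootValue-different {suc (suc _)} {_}           (s≤s (s≤s ())) _              _
rootValue-different {_}           {suc (suc _)} _              (s≤s (s≤s ())) _

proposition3 : (m n : ℕ) → 2 ≤ m → 2 ≤ n →
    (m % 2 ≡ n % 2 → (g : ℕ) → HasGrundy (K m n) [] g ⇔ g ≡ 0)
    × (¬ (m % 2 ≡ n % 2) → (g : ℕ) → HasGrundy (K m n) [] g ⇔ g ≡ 2)
proposition3 m n 2≤m 2≤n =
  (λ same → characterise (rootValue-same (m%n<n m 2) (m%n<n n 2) same)) ,
  (λ different → characterise (rootValue-different (m%n<n m 2) (m%n<n n 2) different))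
  where
  characterise : ∀ {r} → rootValue (m % 2) (n % 2) ≡ r →
                 (g : ℕ) → HasGrundy (K m n) [] g ⇔ g ≡ r
  characterise refl g = mk⇔ (λ value-g → HasGrundy-functional value-g (HasGrundy-K 2≤m 2≤n))
                            (λ { refl → HasGrundy-K 2≤m 2≤n })
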